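{- Let $a\geq2$ be an integer and $b\in\mathbb{C}$ with $b\neq1,2$. Then \[P_{a,b}(X,Y)=\sum_{j=0}^{a-2}\binom{a+b-3}{j}X^jY^{a-2-j}=\sum_{j=0}^{a-2}\binom{a+b-3}{a-2-j}\binom{j+b-2}{j}(X+Y)^{a-2-j}(-Y)^j.\]
   Context: $P_{a,b}(X,Y):=\sum_{j=0}^{a-2}\binom{j+b-2}{j}X^j(X+Y)^{a-j-2}\in\mathbb{C}[X,Y]$, with generalized binomial coefficients $\binom{x}{j}=x(x-1)\cdots(x-j+1)/j!$ for $x\in\mathbb{C}$, $j\in\mathbb{N}_0$. -}

module Defs where

open import Level using (Level)
open import Data.Nat using (ℕ; zero; suc)
open import Data.Nat.Base using () renaming (_! to _!ℕ)
open import Algebra.Bundles using (CommutativeRing)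

-- Everything is parametrised by a commutative ring R (in the paper: ℂ, or ℂ[X,Y])
-- together with a function `inv` giving inverses of the positive naturals
-- (the hypothesis that it does so is stated separately, see `InvertsPositives`).
module Gen {c ℓ : Level} (R : CommutativeRing c ℓ) where
  open CommutativeRing R

  ι : ℕ → Carrier
  ι zero    = 0#
  ι (suc n) = 1# + ι n

  infixr 8 _^_
  _^_ : Carrier → ℕ → Carrier
  x ^ zero  = 1#
  x ^ suc n = x * x ^ n

  InvertsPositives : (ℕ → Carrier) → Set ℓ
  InvertsPositives inv = ∀ n → ι (suc n) * inv (suc n) ≈ 1#

  falling : Carrier → ℕ → Carrier
  falling x zero    = 1#
  falling x (suc j) = falling x j * (x - ι j)

  binom : (ℕ → Carrier) → Carrier → ℕ → Carrier
  binom inv x j = falling x j * inv (j !ℕ)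

  sumUpTo : ℕ → (ℕ → Carrier) → Carrier
  sumUpTo zero    f = f 0
  sumUpTo (suc n) f = sumUpTo n f + f (suc n)

  P : (ℕ → Carrier) → ℕ → Carrier → Carrier → Carrier → Carrier
  P inv a b X Y = sumUpTo (a Data.Nat.∸ 2) λ j →
    binom inv (ι j + b - ι 2) j * X ^ j * (X + Y) ^ (a Data.Nat.∸ j Data.Nat.∸ 2)

{-# OPTIONS --safe #-}
-- Write n = a − 2, Z = X + Y and β j = binom(j + b − 2, j), so that
-- P = Σ_j β j X^j Z^(n−j). Splitting off the last term gives the recurrence
--   P_{n+1} = Z P_n + β (n+1) X^(n+1),   P_0 = 1,
-- which determines the sequence. Both right-hand sides are binomial sums with
-- upper index a + b − 3, which grows by one with n; Pascal's rule shows that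
-- they satisfy the same recurrence. For the first this uses only Pascal's rule
-- once more; for the second the new top term collapses, by trinomial revision
-- binom(N + c, k) binom(N − k + c, N − k) = binom(N + c, N) binom(N, k)
-- and the binomial theorem, to β N (Z − Y)^N = β N X^N.
module Submission where

open import Defs
open import Level using (Level)
open import Data.Nat as ℕ using (ℕ; _≤_; _∸_; zero; suc; s≤s; z≤n; NonZero)
open import Data.Product using (_×_; _,_)
open import Relation.Nullary using (¬_)
open import Algebra.Bundles using (CommutativeRing)
open import Data.Nat.Base using () renaming (_! to _!ℕ)
import Data.Nat.Properties as ℕP
open import Data.Integer as ℤ using (ℤ; +_; -[1+_])
import Data.Integer.Properties as ℤP
open import Data.Sign as Sign using (Sign)
open import Data.Maybe using (Maybe; map)
open import Function using (const)
open import Relation.Binary.Consequences using (dec⇒weaklyDec)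
import Relation.Binary.PropositionalEquality as ≡
open import Algebra.Solver.Ring.AlmostCommutativeRing
  using (fromCommutativeRing; _-Raw-AlmostCommutative⟶_)

module _ {c ℓ : Level} (R : CommutativeRing c ℓ) where
  open CommutativeRing R
  open Gen R
  open import Algebra.Properties.Ring ring using (-0#≈0#; -‿involutive; -1*x≈-x; -‿+-comm)
  open import Algebra.Properties.CommutativeSemigroup +-commutativeSemigroup
    using () renaming (interchange to +-interchange)
  open import Algebra.Properties.CommutativeSemigroup *-commutativeSemigroup
    using () renaming (interchange to *-interchange)
  import Algebra.Properties.Semiring.Mult semiring as Mult
  open import Relation.Binary.Reasoning.Setoid setoid

  ι≈×1# : ∀ n → ι n ≈ n Mult.× 1#
  ι≈×1# zero    = refl
  ι≈×1# (suc n) = +-congˡ (ι≈×1# n)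

  ι-+ : ∀ m n → ι (m ℕ.+ n) ≈ ι m + ι n
  ι-+ m n = trans (ι≈×1# (m ℕ.+ n))
    (trans (Mult.×-homo-+ 1# m n) (sym (+-cong (ι≈×1# m) (ι≈×1# n))))

  ι-* : ∀ m n → ι (m ℕ.* n) ≈ ι m * ι n
  ι-* m n = trans (ι≈×1# (m ℕ.* n))
    (trans (Mult.×1-homo-* m n) (sym (*-cong (ι≈×1# m) (ι≈×1# n))))

  [1+x]-[1+y]≈x-y : ∀ x y → (1# + x) - (1# + y) ≈ x - y
  [1+x]-[1+y]≈x-y x y = begin
    (1# + x) + - (1# + y)   ≈⟨ +-congˡ (-‿+-comm 1# y) ⟨
    (1# + x) + (- 1# + - y) ≈⟨ +-interchange 1# x (- 1#) (- y) ⟩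
    (1# - 1#) + (x - y)     ≈⟨ +-congʳ (-‿inverseʳ 1#) ⟩
    0# + (x - y)            ≈⟨ +-identityˡ (x - y) ⟩
    x - y                   ∎

  fromSign : Sign → Carrier
  fromSign Sign.+ = 1#
  fromSign Sign.- = - 1#

  fromℤ : ℤ → Carrier
  fromℤ (+ n)     = ι n
  fromℤ -[1+ n ] = - ι (suc n)

  fromSign-* : ∀ s t → fromSign (s Sign.* t) ≈ fromSign s * fromSign t
  fromSign-* Sign.+ t      = sym (*-identityˡ _)
  fromSign-* Sign.- Sign.+ = sym (*-identityʳ _)
  fromSign-* Sign.- Sign.- = sym (trans (-1*x≈-x (- 1#)) (-‿involutive 1#))

  fromℤ-◃ : ∀ s n → fromℤ (s ℤ.◃ n) ≈ fromSign s * ι n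
  fromℤ-◃ s      zero    = sym (zeroʳ _)
  fromℤ-◃ Sign.+ (suc n) = sym (*-identityˡ _)
  fromℤ-◃ Sign.- (suc n) = sym (-1*x≈-x _)

  fromℤ-signAbs : ∀ i → fromℤ i ≈ fromSign (ℤ.sign i) * ι ℤ.∣ i ∣
  fromℤ-signAbs i = trans (reflexive (≡.cong fromℤ (≡.sym (ℤP.◃-inverse i))))
                          (fromℤ-◃ (ℤ.sign i) ℤ.∣ i ∣)

  fromℤ-⊖ : ∀ m n → fromℤ (m ℤ.⊖ n) ≈ ι m - ι n
  fromℤ-⊖ m       zero    = sym (trans (+-congˡ -0#≈0#) (+-identityʳ _))
  fromℤ-⊖ zero    (suc n) = sym (+-identityˡ _)
  fromℤ-⊖ (suc m) (suc n) = begin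
    fromℤ (suc m ℤ.⊖ suc n) ≡⟨ ≡.cong fromℤ (ℤP.[1+m]⊖[1+n]≡m⊖n m n) ⟩
    fromℤ (m ℤ.⊖ n)         ≈⟨ fromℤ-⊖ m n ⟩
    ι m - ι n               ≈⟨ [1+x]-[1+y]≈x-y (ι m) (ι n) ⟨
    ι (suc m) - ι (suc n)   ∎

  fromℤ-+ : ∀ i j → fromℤ (i ℤ.+ j) ≈ fromℤ i + fromℤ j
  fromℤ-+ (+ m)     (+ n)     = ι-+ m n
  fromℤ-+ (+ m)     -[1+ n ] = fromℤ-⊖ m (suc n)
  fromℤ-+ -[1+ m ] (+ n)     = trans (fromℤ-⊖ n (suc m)) (+-comm _ _)
  fromℤ-+ -[1+ m ] -[1+ n ] = begin
    - ι (suc (suc (m ℕ.+ n)))   ≡⟨ ≡.cong (λ k → - ι (suc k)) (ℕP.+-suc m n) ⟨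
    - ι (suc m ℕ.+ suc n)       ≈⟨ -‿cong (ι-+ (suc m) (suc n)) ⟩
    - (ι (suc m) + ι (suc n))   ≈⟨ -‿+-comm _ _ ⟨
    - ι (suc m) + - ι (suc n)   ∎

  fromℤ-* : ∀ i j → fromℤ (i ℤ.* j) ≈ fromℤ i * fromℤ j
  fromℤ-* i j = begin
    fromℤ (s ℤ.◃ (ℤ.∣ i ∣ ℕ.* ℤ.∣ j ∣))                            ≈⟨ fromℤ-◃ s (ℤ.∣ i ∣ ℕ.* ℤ.∣ j ∣) ⟩
    fromSign s * ι (ℤ.∣ i ∣ ℕ.* ℤ.∣ j ∣)                            ≈⟨ *-cong (fromSign-* (ℤ.sign i) (ℤ.sign j)) (ι-* ℤ.∣ i ∣ ℤ.∣ j ∣) ⟩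
    (fromSign (ℤ.sign i) * fromSign (ℤ.sign j)) * (ι ℤ.∣ i ∣ * ι ℤ.∣ j ∣) ≈⟨ *-interchange _ _ _ _ ⟩
    (fromSign (ℤ.sign i) * ι ℤ.∣ i ∣) * (fromSign (ℤ.sign j) * ι ℤ.∣ j ∣) ≈⟨ *-cong (fromℤ-signAbs i) (fromℤ-signAbs j) ⟨
    fromℤ i * fromℤ j                                               ∎
    where s = ℤ.sign i Sign.* ℤ.sign j

  fromℤ-neg : ∀ i → fromℤ (ℤ.- i) ≈ - fromℤ i
  fromℤ-neg (+ zero)  = sym -0#≈0#
  fromℤ-neg (+ suc n) = refl
  fromℤ-neg -[1+ n ] = sym (-‿involutive _)

  -- Agrees with ι but sends 1 to 1# on the nose, so that the solver's constant
  -- con (+ 1) is read back as 1#.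
  ι′ : ℕ → Carrier
  ι′ zero          = 0#
  ι′ (suc zero)    = 1#
  ι′ (suc (suc n)) = 1# + ι′ (suc n)

  ι′≈ι : ∀ n → ι′ n ≈ ι n
  ι′≈ι zero          = refl
  ι′≈ι (suc zero)    = sym (+-identityʳ 1#)
  ι′≈ι (suc (suc n)) = +-congˡ (ι′≈ι (suc n))

  fromℤ′ : ℤ → Carrier
  fromℤ′ (+ n)     = ι′ n
  fromℤ′ -[1+ n ] = - ι′ (suc n)

  fromℤ′≈fromℤ : ∀ i → fromℤ′ i ≈ fromℤ i
  fromℤ′≈fromℤ (+ n)     = ι′≈ι n
  fromℤ′≈fromℤ -[1+ n ] = -‿cong (ι′≈ι (suc n))

  fromℤ′-morphism : ℤ.+-*-rawRing -Raw-AlmostCommutative⟶ fromCommutativeRing R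
  fromℤ′-morphism = record
    { ⟦_⟧    = fromℤ′
    ; +-homo = λ i j → transfer (i ℤ.+ j) (fromℤ-+ i j) (+-cong (fromℤ′≈fromℤ i) (fromℤ′≈fromℤ j))
    ; *-homo = λ i j → transfer (i ℤ.* j) (fromℤ-* i j) (*-cong (fromℤ′≈fromℤ i) (fromℤ′≈fromℤ j))
    ; -‿homo = λ i → transfer (ℤ.- i) (fromℤ-neg i) (-‿cong (fromℤ′≈fromℤ i))
    ; 0-homo = refl
    ; 1-homo = refl
    }
    where
    transfer : ∀ i {x y} → fromℤ i ≈ x → y ≈ x → fromℤ′ i ≈ y
    transfer i fromℤ≈x y≈x = trans (fromℤ′≈fromℤ i) (trans fromℤ≈x (sym y≈x))

  fromℤ′-weaklyDecidable : ∀ i j → Maybe (fromℤ′ i ≈ fromℤ′ j)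
  fromℤ′-weaklyDecidable i j = map (λ { ≡.refl → refl }) (dec⇒weaklyDec ℤ._≟_ i j)

  open import Algebra.Solver.Ring ℤ.+-*-rawRing (fromCommutativeRing R)
    fromℤ′-morphism fromℤ′-weaklyDecidable

  ^-congˡ : ∀ n {x y} → x ≈ y → x ^ n ≈ y ^ n
  ^-congˡ zero    x≈y = refl
  ^-congˡ (suc n) x≈y = *-cong x≈y (^-congˡ n x≈y)

  sumUpTo-cong≤ : ∀ n {f g : ℕ → Carrier} → (∀ j → j ≤ n → f j ≈ g j) →
                  sumUpTo n f ≈ sumUpTo n g
  sumUpTo-cong≤ zero    f≈g = f≈g 0 z≤n
  sumUpTo-cong≤ (suc n) f≈g =
    +-cong (sumUpTo-cong≤ n (λ j j≤n → f≈g j (ℕP.m≤n⇒m≤1+n j≤n))) (f≈g (suc n) ℕP.≤-refl)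

  sumUpTo-cong : ∀ n {f g : ℕ → Carrier} → (∀ j → f j ≈ g j) → sumUpTo n f ≈ sumUpTo n g
  sumUpTo-cong n f≈g = sumUpTo-cong≤ n (λ j _ → f≈g j)

  sumUpTo-peelˡ : ∀ n (f : ℕ → Carrier) → sumUpTo (suc n) f ≈ f 0 + sumUpTo n (λ j → f (suc j))
  sumUpTo-peelˡ zero    f = refl
  sumUpTo-peelˡ (suc n) f = trans (+-congʳ (sumUpTo-peelˡ n f)) (+-assoc _ _ _)

  sumUpTo-+ : ∀ n (f g : ℕ → Carrier) →
              sumUpTo n (λ j → f j + g j) ≈ sumUpTo n f + sumUpTo n g
  sumUpTo-+ zero    f g = refl
  sumUpTo-+ (suc n) f g = trans (+-congʳ (sumUpTo-+ n f g)) (+-interchange _ _ _ _)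

  sumUpTo-*ˡ : ∀ n x (f : ℕ → Carrier) → sumUpTo n (λ j → x * f j) ≈ x * sumUpTo n f
  sumUpTo-*ˡ zero    x f = refl
  sumUpTo-*ˡ (suc n) x f = trans (+-congʳ (sumUpTo-*ˡ n x f)) (sym (distribˡ _ _ _))

  sumUpTo-reverse : ∀ n (f : ℕ → Carrier) → sumUpTo n f ≈ sumUpTo n (λ j → f (n ∸ j))
  sumUpTo-reverse zero    f = refl
  sumUpTo-reverse (suc n) f = begin
    sumUpTo n f + f (suc n)                          ≈⟨ +-congʳ (sumUpTo-reverse n f) ⟩
    sumUpTo n (λ j → f (n ∸ j)) + f (suc n)          ≈⟨ +-comm _ _ ⟩
    f (suc n) + sumUpTo n (λ j → f (n ∸ j))          ≈⟨ sumUpTo-peelˡ n (λ j → f (suc n ∸ j)) ⟨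
    sumUpTo (suc n) (λ j → f (suc n ∸ j))            ∎

  sumUpTo-horner : ∀ n (g : ℕ → Carrier) r →
                   sumUpTo (suc n) (λ j → g j * r ^ (suc n ∸ j))
                     ≈ r * sumUpTo n (λ j → g j * r ^ (n ∸ j)) + g (suc n)
  sumUpTo-horner n g r = +-cong (trans (sumUpTo-cong≤ n factor-r) (sumUpTo-*ˡ n r _)) top
    where
    factor-r : ∀ j → j ≤ n → g j * r ^ (suc n ∸ j) ≈ r * (g j * r ^ (n ∸ j))
    factor-r j j≤n = begin
      g j * r ^ (suc n ∸ j)     ≡⟨ ≡.cong (λ e → g j * r ^ e) (ℕP.+-∸-assoc 1 j≤n) ⟩
      g j * (r * r ^ (n ∸ j))   ≈⟨ solve 3 (λ u r v → u :* (r :* v) := r :* (u :* v)) refl (g j) r (r ^ (n ∸ j)) ⟩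
      r * (g j * r ^ (n ∸ j))   ∎
    top : g (suc n) * r ^ (n ∸ n) ≈ g (suc n)
    top = trans (reflexive (≡.cong (λ e → g (suc n) * r ^ e) (ℕP.n∸n≡0 n))) (*-identityʳ _)

  recurrence-unique : ∀ z (t u v : ℕ → Carrier) → u 0 ≈ v 0 →
                      (∀ n → u (suc n) ≈ z * u n + t n) →
                      (∀ n → v (suc n) ≈ z * v n + t n) →
                      ∀ n → u n ≈ v n
  recurrence-unique z t u v u₀≈v₀ u-step v-step zero    = u₀≈v₀
  recurrence-unique z t u v u₀≈v₀ u-step v-step (suc n) =
    trans (u-step n)
      (trans (+-congʳ (*-congˡ (recurrence-unique z t u v u₀≈v₀ u-step v-step n)))
        (sym (v-step n)))

  falling-cong : ∀ j {x y} → x ≈ y → falling x j ≈ falling y j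
  falling-cong zero    x≈y = refl
  falling-cong (suc j) x≈y = *-cong (falling-cong j x≈y) (+-congʳ x≈y)

  falling-pascal : ∀ x j → falling (1# + x) (suc j) ≈ falling x (suc j) + ι (suc j) * falling x j
  falling-pascal x zero = solve 1
    (λ x → con (+ 1) :* ((con (+ 1) :+ x) :- con (+ 0))
           := con (+ 1) :* (x :- con (+ 0)) :+ (con (+ 1) :+ con (+ 0)) :* con (+ 1)) refl x
  falling-pascal x (suc j) = trans (*-congʳ (falling-pascal x j)) (solve 3
    (λ f x k → (f :* (x :- k) :+ (con (+ 1) :+ k) :* f) :* ((con (+ 1) :+ x) :- (con (+ 1) :+ k))
               := f :* (x :- k) :* (x :- (con (+ 1) :+ k)) :+ (con (+ 1) :+ (con (+ 1) :+ k)) :* (f :* (x :- k)))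
    refl (falling x j) x (ι j))

  falling-+ : ∀ x k p → falling x (k ℕ.+ p) ≈ falling x k * falling (x - ι k) p
  falling-+ x k zero    rewrite ℕP.+-identityʳ k = sym (*-identityʳ _)
  falling-+ x k (suc p) rewrite ℕP.+-suc k p = begin
    falling x (k ℕ.+ p) * (x - ι (k ℕ.+ p))               ≈⟨ *-cong (falling-+ x k p) (+-congˡ (-‿cong (ι-+ k p))) ⟩
    falling x k * falling (x - ι k) p * (x - (ι k + ι p)) ≈⟨ solve 5 (λ f g x u v → f :* g :* (x :- (u :+ v)) := f :* (g :* ((x :- u) :- v)))
                                                               refl (falling x k) (falling (x - ι k) p) x (ι k) (ι p) ⟩
    falling x k * (falling (x - ι k) p * (x - ι k - ι p)) ∎

  falling-ι-! : ∀ n → falling (ι n) n ≈ ι (n !ℕ)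
  falling-ι-! zero    = sym (+-identityʳ 1#)
  falling-ι-! (suc n) = begin
    falling (ι (suc n)) (1 ℕ.+ n)                      ≈⟨ falling-+ (ι (suc n)) 1 n ⟩
    falling (ι (suc n)) 1 * falling (ι (suc n) - ι 1) n ≈⟨ *-cong (solve 1 (λ u → con (+ 1) :* ((con (+ 1) :+ u) :- con (+ 0)) := con (+ 1) :+ u) refl (ι n))
                                                                  (falling-cong n (solve 1 (λ u → (con (+ 1) :+ u) :- (con (+ 1) :+ con (+ 0)) := u) refl (ι n))) ⟩
    ι (suc n) * falling (ι n) n                        ≈⟨ *-congˡ (falling-ι-! n) ⟩
    ι (suc n) * ι (n !ℕ)                               ≈⟨ ι-* (suc n) (n !ℕ) ⟨
    ι (suc n !ℕ)                                       ∎

  falling-ι-vanish : ∀ n → falling (ι n) (suc n) ≈ 0#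
  falling-ι-vanish n = trans (*-congˡ (-‿inverseʳ (ι n))) (zeroʳ _)

  ι-!-+ : ∀ k p → ι ((k ℕ.+ p) !ℕ) ≈ falling (ι (k ℕ.+ p)) k * ι (p !ℕ)
  ι-!-+ k p = begin
    ι ((k ℕ.+ p) !ℕ)                                      ≈⟨ falling-ι-! (k ℕ.+ p) ⟨
    falling (ι (k ℕ.+ p)) (k ℕ.+ p)                       ≈⟨ falling-+ (ι (k ℕ.+ p)) k p ⟩
    falling (ι (k ℕ.+ p)) k * falling (ι (k ℕ.+ p) - ι k) p ≈⟨ *-congˡ (falling-cong p ι[k+p]-ι[k]≈ι[p]) ⟩
    falling (ι (k ℕ.+ p)) k * falling (ι p) p              ≈⟨ *-congˡ (falling-ι-! p) ⟩
    falling (ι (k ℕ.+ p)) k * ι (p !ℕ)                     ∎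
    where
    ι[k+p]-ι[k]≈ι[p] : ι (k ℕ.+ p) - ι k ≈ ι p
    ι[k+p]-ι[k]≈ι[p] = trans (+-congʳ (ι-+ k p)) (solve 2 (λ u v → (u :+ v) :- u := v) refl (ι k) (ι p))

  inverse-of-factor : ∀ {x x′ y y′} u → x * x′ ≈ 1# → y * y′ ≈ 1# → y ≈ u * x → x′ ≈ u * y′
  inverse-of-factor {x} {x′} {y} {y′} u xx′≈1 yy′≈1 y≈ux = begin
    x′                  ≈⟨ *-identityʳ x′ ⟨
    x′ * 1#             ≈⟨ *-congˡ yy′≈1 ⟨
    x′ * (y * y′)       ≈⟨ *-congˡ (*-congʳ y≈ux) ⟩
    x′ * (u * x * y′)   ≈⟨ solve 4 (λ x x′ u y′ → x′ :* (u :* x :* y′) := x :* x′ :* (u :* y′)) refl x x′ u y′ ⟩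
    x * x′ * (u * y′)   ≈⟨ *-congʳ xx′≈1 ⟩
    1# * (u * y′)       ≈⟨ *-identityˡ _ ⟩
    u * y′              ∎

  module _ (inv : ℕ → Carrier) (invertsPositives : InvertsPositives inv) where

    inv-nonZero : ∀ m → .{{NonZero m}} → ι m * inv m ≈ 1#
    inv-nonZero (suc m) = invertsPositives m

    inv-! : ∀ n → ι (n !ℕ) * inv (n !ℕ) ≈ 1#
    inv-! n = inv-nonZero (n !ℕ) {{ℕP._!≢0 n}}

    binom-cong : ∀ j {x y} → x ≈ y → binom inv x j ≈ binom inv y j
    binom-cong j x≈y = *-congʳ (falling-cong j x≈y)

    binom-zero : ∀ x → binom inv x 0 ≈ 1#
    binom-zero x = trans (*-congʳ (sym (+-identityʳ 1#))) (invertsPositives 0)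

    binom-pascal : ∀ x j → binom inv (1# + x) (suc j) ≈ binom inv x (suc j) + binom inv x j
    binom-pascal x j = begin
      falling (1# + x) (suc j) * i₁                     ≈⟨ *-congʳ (falling-pascal x j) ⟩
      (falling x (suc j) + ι (suc j) * falling x j) * i₁ ≈⟨ solve 4 (λ f₁ k f₀ i → (f₁ :+ k :* f₀) :* i := f₁ :* i :+ f₀ :* (k :* i))
                                                                refl (falling x (suc j)) (ι (suc j)) (falling x j) i₁ ⟩
      falling x (suc j) * i₁ + falling x j * (ι (suc j) * i₁) ≈⟨ +-congˡ (*-congˡ i₀≈[j+1]i₁) ⟨
      falling x (suc j) * i₁ + falling x j * inv (j !ℕ)      ∎
      where
      i₁ = inv (suc j !ℕ)
      i₀≈[j+1]i₁ : inv (j !ℕ) ≈ ι (suc j) * i₁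
      i₀≈[j+1]i₁ = inverse-of-factor (ι (suc j)) (inv-! j) (inv-! (suc j)) (ι-* (suc j) (j !ℕ))

    binom-ι-vanish : ∀ n → binom inv (ι n) (suc n) ≈ 0#
    binom-ι-vanish n = trans (*-congʳ (falling-ι-vanish n)) (zeroˡ _)

    binom-trinomial : ∀ x k p → binom inv x k * binom inv (x - ι k) p
                                ≈ binom inv x (k ℕ.+ p) * binom inv (ι (k ℕ.+ p)) k
    binom-trinomial x k p = begin
      falling x k * inv (k !ℕ) * (falling (x - ι k) p * inv (p !ℕ))  ≈⟨ *-congˡ (*-congˡ iₚ≈fiₙ) ⟩
      fₖ * inv (k !ℕ) * (fₚ * (falling (ι N) k * inv (N !ℕ)))        ≈⟨ solve 5 (λ fₖ iₖ fₚ f iₙ → fₖ :* iₖ :* (fₚ :* (f :* iₙ)) := fₖ :* fₚ :* iₙ :* (f :* iₖ))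
                                                                           refl fₖ (inv (k !ℕ)) fₚ (falling (ι N) k) (inv (N !ℕ)) ⟩
      fₖ * fₚ * inv (N !ℕ) * (falling (ι N) k * inv (k !ℕ))           ≈⟨ *-congʳ (*-congʳ (falling-+ x k p)) ⟨
      falling x N * inv (N !ℕ) * (falling (ι N) k * inv (k !ℕ))       ∎
      where
      N = k ℕ.+ p
      fₖ = falling x k
      fₚ = falling (x - ι k) p
      iₚ≈fiₙ : inv (p !ℕ) ≈ falling (ι N) k * inv (N !ℕ)
      iₚ≈fiₙ = inverse-of-factor (falling (ι N) k) (inv-! p) (inv-! N) (ι-!-+ k p)

    binom-revision : ∀ c N k → k ≤ N →
                     binom inv (ι N + c) k * binom inv (ι (N ∸ k) + c) (N ∸ k)
                       ≈ binom inv (ι N + c) N * binom inv (ι N) k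
    binom-revision c N k k≤N with N ∸ k | ℕP.m+[n∸m]≡n k≤N
    ... | p | ≡.refl = trans (*-congˡ (binom-cong p (sym ι[k+p]+c-ι[k]≈ι[p]+c))) (binom-trinomial _ k p)
      where
      ι[k+p]+c-ι[k]≈ι[p]+c : ι (k ℕ.+ p) + c - ι k ≈ ι p + c
      ι[k+p]+c-ι[k]≈ι[p]+c = trans (+-congʳ (+-congʳ (ι-+ k p)))
        (solve 3 (λ u v c → u :+ v :+ c :- u := v :+ c) refl (ι k) (ι p) c)

    binomialSum : Carrier → (ℕ → Carrier) → Carrier → Carrier → ℕ → Carrier
    binomialSum x w p q N = sumUpTo N (λ k → binom inv x k * w (N ∸ k) * p ^ k * q ^ (N ∸ k))

    binomialSum-cong : ∀ w p q N {x y} → x ≈ y → binomialSum x w p q N ≈ binomialSum y w p q N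
    binomialSum-cong w p q N x≈y = sumUpTo-cong N (λ k → *-congʳ (*-congʳ (*-congʳ (binom-cong k x≈y))))

    binomialSum-pascal : ∀ x w p q N →
                         binomialSum (1# + x) w p q (suc N) ≈ p * binomialSum x w p q N + binomialSum x w p q (suc N)
    binomialSum-pascal x w p q N = begin
      binomialSum (1# + x) w p q (suc N)                       ≈⟨ sumUpTo-peelˡ N _ ⟩
      t₀ + sumUpTo N (λ k → term (1# + x) (suc k) k)           ≈⟨ +-congˡ (sumUpTo-cong N split) ⟩
      t₀ + sumUpTo N (λ k → term x (suc k) k + p * term x k k) ≈⟨ +-congˡ (sumUpTo-+ N _ _) ⟩
      t₀ + (sumUpTo N (λ k → term x (suc k) k)
              + sumUpTo N (λ k → p * term x k k))              ≈⟨ +-congˡ (+-congˡ (sumUpTo-*ˡ N p _)) ⟩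
      t₀ + (s₁ + p * binomialSum x w p q N)
        ≈⟨ solve 4 (λ t s p e → t :+ (s :+ p :* e) := p :* e :+ (t :+ s)) refl t₀ s₁ p (binomialSum x w p q N) ⟩
      p * binomialSum x w p q N + (t₀ + s₁)                    ≈⟨ +-congˡ (sumUpTo-peelˡ N _) ⟨
      p * binomialSum x w p q N + binomialSum x w p q (suc N)  ∎
      where
      term : Carrier → ℕ → ℕ → Carrier
      term y k i = binom inv y k * w (N ∸ i) * p ^ k * q ^ (N ∸ i)
      t₀ = binom inv x 0 * w (suc N) * 1# * q ^ suc N
      s₁ = sumUpTo N (λ k → term x (suc k) k)
      split : ∀ k → term (1# + x) (suc k) k ≈ term x (suc k) k + p * term x k k
      split k = trans (*-congʳ (*-congʳ (*-congʳ (binom-pascal x k)))) (solve 6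
        (λ b₁ b₀ u p pk qk → (b₁ :+ b₀) :* u :* (p :* pk) :* qk := b₁ :* u :* (p :* pk) :* qk :+ p :* (b₀ :* u :* pk :* qk))
        refl (binom inv x (suc k)) (binom inv x k) (w (N ∸ k)) p (p ^ k) (q ^ (N ∸ k)))

    binomialSum-top : ∀ x p q N → binomialSum x (const 1#) p q (suc N)
                                  ≈ q * binomialSum x (const 1#) p q N + binom inv x (suc N) * 1# * p ^ suc N
    binomialSum-top x p q N = sumUpTo-horner N (λ k → binom inv x k * 1# * p ^ k) q

    binomial-theorem : ∀ p q N → binomialSum (ι N) (const 1#) p q N ≈ (p + q) ^ N
    binomial-theorem p q zero = trans (solve 1 (λ b → b :* con (+ 1) :* con (+ 1) :* con (+ 1) := b) refl (binom inv 0# 0))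
                                      (binom-zero 0#)
    binomial-theorem p q (suc N) = begin
      binomialSum (1# + ι N) (const 1#) p q (suc N)              ≈⟨ binomialSum-pascal (ι N) (const 1#) p q N ⟩
      p * e + binomialSum (ι N) (const 1#) p q (suc N)           ≈⟨ +-congˡ (binomialSum-top (ι N) p q N) ⟩
      p * e + (q * e + binom inv (ι N) (suc N) * 1# * p ^ suc N) ≈⟨ +-congˡ (+-congˡ (*-congʳ (*-congʳ (binom-ι-vanish N)))) ⟩
      p * e + (q * e + 0# * 1# * p ^ suc N)
        ≈⟨ solve 4 (λ p q e u → p :* e :+ (q :* e :+ con (+ 0) :* con (+ 1) :* u) := (p :+ q) :* e) refl p q e (p ^ suc N) ⟩
      (p + q) * e                                                ≈⟨ *-congˡ (binomial-theorem p q N) ⟩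
      (p + q) * (p + q) ^ N                                      ∎
      where e = binomialSum (ι N) (const 1#) p q N

    module _ (b X Y : Carrier) where

      β : ℕ → Carrier
      β j = binom inv (ι j + b - ι 2) j

      μ : ℕ → Carrier
      μ n = ι (suc (suc n)) + b - ι 3

      μ-suc : ∀ n → μ (suc n) ≈ 1# + μ n
      μ-suc n = solve 3 (λ u b t → con (+ 1) :+ u :+ b :- t := con (+ 1) :+ (u :+ b :- t)) refl (ι (suc (suc n))) b (ι 3)

      μ≈ι+b-2 : ∀ n → μ n ≈ ι (suc n) + b - ι 2
      μ≈ι+b-2 n = solve 3 (λ u b t → con (+ 1) :+ u :+ b :- (con (+ 1) :+ t) := u :+ b :- t) refl (ι (suc n)) b (ι 2)

      Recurrence : (ℕ → Carrier) → Set ℓ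
      Recurrence u = ∀ n → u (suc n) ≈ (X + Y) * u n + β (suc n) * X ^ suc n

      β-zero : β 0 ≈ 1#
      β-zero = binom-zero (ι 0 + b - ι 2)

      binomialSum-μ-suc : ∀ w p q n → binomialSum (μ (suc n)) w p q (suc n)
                                      ≈ p * binomialSum (μ n) w p q n + binomialSum (μ n) w p q (suc n)
      binomialSum-μ-suc w p q n =
        trans (binomialSum-cong w p q (suc n) (μ-suc n)) (binomialSum-pascal (μ n) w p q n)

      Pₙ : ℕ → Carrier
      Pₙ n = sumUpTo n (λ j → β j * X ^ j * (X + Y) ^ (n ∸ j))

      Pₙ-recurrence : Recurrence Pₙ
      Pₙ-recurrence n = sumUpTo-horner n (λ j → β j * X ^ j) (X + Y)

      Pₙ-zero : Pₙ 0 ≈ 1#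
      Pₙ-zero = trans (*-identityʳ _) (trans (*-identityʳ _) β-zero)

      firstSum : ℕ → Carrier
      firstSum n = binomialSum (μ n) (const 1#) X Y n

      firstSum-recurrence : Recurrence firstSum
      firstSum-recurrence n = begin
        firstSum (suc n)                                        ≈⟨ binomialSum-μ-suc (const 1#) X Y n ⟩
        X * firstSum n + binomialSum (μ n) (const 1#) X Y (suc n) ≈⟨ +-congˡ (binomialSum-top (μ n) X Y n) ⟩
        X * firstSum n + (Y * firstSum n + binom inv (μ n) (suc n) * 1# * Xⁿ⁺¹)
          ≈⟨ +-congˡ (+-congˡ (*-congʳ (*-congʳ (binom-cong (suc n) (μ≈ι+b-2 n))))) ⟩
        X * firstSum n + (Y * firstSum n + β (suc n) * 1# * Xⁿ⁺¹)
          ≈⟨ solve 5 (λ X Y f β x → X :* f :+ (Y :* f :+ β :* con (+ 1) :* x) := (X :+ Y) :* f :+ β :* x)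
                     refl X Y (firstSum n) (β (suc n)) Xⁿ⁺¹ ⟩
        (X + Y) * firstSum n + β (suc n) * Xⁿ⁺¹                 ∎
        where Xⁿ⁺¹ = X ^ suc n

      firstSum-zero : firstSum 0 ≈ 1#
      firstSum-zero = trans (*-identityʳ _) (trans (*-identityʳ _) (trans (*-identityʳ _) (binom-zero (μ 0))))

      secondSum : ℕ → Carrier
      secondSum n = binomialSum (μ n) β (X + Y) (- Y) n

      secondSum-top : ∀ n → binomialSum (μ n) β (X + Y) (- Y) (suc n) ≈ β (suc n) * X ^ suc n
      secondSum-top n = begin
        binomialSum (μ n) β (X + Y) (- Y) N                   ≈⟨ sumUpTo-cong≤ N revise ⟩
        sumUpTo N (λ k → β N * (binom inv (ι N) k * 1# * (X + Y) ^ k * (- Y) ^ (N ∸ k))) ≈⟨ sumUpTo-*ˡ N (β N) _ ⟩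
        β N * binomialSum (ι N) (const 1#) (X + Y) (- Y) N    ≈⟨ *-congˡ (binomial-theorem (X + Y) (- Y) N) ⟩
        β N * (X + Y + - Y) ^ N                               ≈⟨ *-congˡ (^-congˡ N (solve 2 (λ X Y → X :+ Y :+ :- Y := X) refl X Y)) ⟩
        β N * X ^ N                                           ∎
        where
        N = suc n
        β≈binom : ∀ j → β j ≈ binom inv (ι j + (b - ι 2)) j
        β≈binom j = binom-cong j (+-assoc _ _ _)
        coefficient : ∀ k → k ≤ N → binom inv (μ n) k * β (N ∸ k) ≈ β N * binom inv (ι N) k
        coefficient k k≤N = begin
          binom inv (μ n) k * β (N ∸ k)                          ≈⟨ *-cong (binom-cong k (trans (μ≈ι+b-2 n) (+-assoc _ _ _))) (β≈binom (N ∸ k)) ⟩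
          binom inv (ι N + (b - ι 2)) k * binom inv (ι (N ∸ k) + (b - ι 2)) (N ∸ k) ≈⟨ binom-revision (b - ι 2) N k k≤N ⟩
          binom inv (ι N + (b - ι 2)) N * binom inv (ι N) k      ≈⟨ *-congʳ (β≈binom N) ⟨
          β N * binom inv (ι N) k                                ∎
        revise : ∀ k → k ≤ N → binom inv (μ n) k * β (N ∸ k) * (X + Y) ^ k * (- Y) ^ (N ∸ k)
                               ≈ β N * (binom inv (ι N) k * 1# * (X + Y) ^ k * (- Y) ^ (N ∸ k))
        revise k k≤N = trans (*-congʳ (*-congʳ (coefficient k k≤N))) (solve 4
          (λ β c z w → β :* c :* z :* w := β :* (c :* con (+ 1) :* z :* w))
          refl (β N) (binom inv (ι N) k) ((X + Y) ^ k) ((- Y) ^ (N ∸ k)))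

      secondSum-recurrence : Recurrence secondSum
      secondSum-recurrence n = trans (binomialSum-μ-suc β (X + Y) (- Y) n) (+-congˡ (secondSum-top n))

      secondSum-zero : secondSum 0 ≈ 1#
      secondSum-zero = trans (*-identityʳ _) (trans (*-identityʳ _)
        (trans (*-cong (binom-zero (μ 0)) β-zero) (*-identityʳ 1#)))

      Pₙ≈firstSum : ∀ n → Pₙ n ≈ firstSum n
      Pₙ≈firstSum = recurrence-unique (X + Y) (λ n → β (suc n) * X ^ suc n) Pₙ firstSum
        (trans Pₙ-zero (sym firstSum-zero)) Pₙ-recurrence firstSum-recurrence

      Pₙ≈secondSum : ∀ n → Pₙ n ≈ secondSum n
      Pₙ≈secondSum = recurrence-unique (X + Y) (λ n → β (suc n) * X ^ suc n) Pₙ secondSum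
        (trans Pₙ-zero (sym secondSum-zero)) Pₙ-recurrence secondSum-recurrence

      P≈Pₙ : ∀ n → P inv (suc (suc n)) b X Y ≈ Pₙ n
      P≈Pₙ n = sumUpTo-cong n (λ j → reflexive (≡.cong (λ e → β j * X ^ j * (X + Y) ^ e) (exponent j)))
        where
        exponent : ∀ j → suc (suc n) ∸ j ∸ 2 ≡.≡ n ∸ j
        exponent j = ≡.trans (ℕP.∸-+-assoc (suc (suc n)) j 2) (≡.cong (suc (suc n) ∸_) (ℕP.+-comm j 2))

      firstSum≈unweighted : ∀ n → firstSum n ≈ sumUpTo n (λ j → binom inv (μ n) j * X ^ j * Y ^ (n ∸ j))
      firstSum≈unweighted n = sumUpTo-cong n (λ j → *-congʳ (*-congʳ (*-identityʳ _)))

      secondSum≈reversed : ∀ n → secondSum n ≈ sumUpTo n (λ j → binom inv (μ n) (n ∸ j) * β j * (X + Y) ^ (n ∸ j) * (- Y) ^ j)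
      secondSum≈reversed n = trans (sumUpTo-reverse n _) (sumUpTo-cong≤ n (λ j j≤n →
        reflexive (≡.cong (λ i → binom inv (μ n) (n ∸ j) * β i * (X + Y) ^ (n ∸ j) * (- Y) ^ i)
                          (ℕP.m∸[m∸n]≡n j≤n))))

lemma5p1 : ∀ {c ℓ : Level} (R : CommutativeRing c ℓ) (inv : ℕ → CommutativeRing.Carrier R)
         → Gen.InvertsPositives R inv
         → ∀ (a : ℕ) → 2 ≤ a
         → ∀ (b X Y : CommutativeRing.Carrier R)
         → ¬ CommutativeRing._≈_ R b (Gen.ι R 1)
         → ¬ CommutativeRing._≈_ R b (Gen.ι R 2)
         → let open CommutativeRing R
               open Gen R
           in (P inv a b X Y ≈ sumUpTo (a ∸ 2) (λ j → binom inv (ι a + b - ι 3) j * X ^ j * Y ^ (a ∸ 2 ∸ j)))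
            × (P inv a b X Y ≈ sumUpTo (a ∸ 2) (λ j → binom inv (ι a + b - ι 3) (a ∸ 2 ∸ j) * binom inv (ι j + b - ι 2) j * (X + Y) ^ (a ∸ 2 ∸ j) * (- Y) ^ j))
lemma5p1 R inv invertsPositives (suc (suc n)) (s≤s (s≤s z≤n)) b X Y _ _ =
    trans (P≈Pₙ R inv invertsPositives b X Y n)
      (trans (Pₙ≈firstSum R inv invertsPositives b X Y n) (firstSum≈unweighted R inv invertsPositives b X Y n))
  , trans (P≈Pₙ R inv invertsPositives b X Y n)
      (trans (Pₙ≈secondSum R inv invertsPositives b X Y n) (secondSum≈reversed R inv invertsPositives b X Y n))
  where open CommutativeRing R using (trans)
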